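{- Let $M$ be a $1$-univalent FOLDS-category and $a,b:MO$. The type of indiscernibilities from $a$ to $b$ is equivalent to the type of isomorphisms $a\cong b$ in the precategory associated to $M$.
   Context: Homotopy type theory. A $1$-univalent FOLDS-category $M$ consists of a type $MO$; a family $MA:MO\times MO\to\mathcal{U}$ of sets; families of propositions $MI_x(f)$ for $f:MA(x,x)$, $MT_{x,y,z}(f,g,h)$ for $f:MA(x,y),g:MA(y,z),h:MA(x,z)$, and $ME_{x,y}(f,g)$ for $f,g:MA(x,y)$ with $ME_{x,y}(f,g)\leftrightarrow(f=g)$; satisfying the axioms of a category: each $x$ has a unique $1_x:MA(x,x)$ with $MI_x(1_x)$; each composable $f,g$ has a unique $g\circ f$ with $MT(f,g,g\circ f)$; unit laws and associativity hold. The associated precategory has objects $MO$, hom-sets $MA(x,y)$, identities $1_x$ and composition $\circ$; an isomorphism $a\cong b$ is $f:MA(a,b)$ with $g:MA(b,a)$ such that $g\circ f=1_a$ and $f\circ g=1_b$ (this type is a set, as the inverse is unique). An indiscernibility from $a$ to $b$ consists of equivalences $\phi_{x\bullet}:MA(x,a)\simeq MA(x,b)$ for all $x:MO$, $\phi_{\bullet z}:MA(a,z)\simeq MA(b,z)$ for all $z:MO$, and $\phi_{\bullet\bullet}:MA(a,a)\simeq MA(b,b)$, such that for all $x,y,z,w:MO$ and all $f,g,h$ of the appropriate types: $MT_{x,y,a}(f,g,h)\leftrightarrow MT_{x,y,b}(f,\phi_{y\bullet}(g),\phi_{x\bullet}(h))$; $MT_{x,a,z}(f,g,h)\leftrightarrow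 MT_{x,b,z}(\phi_{x\bullet}(f),\phi_{\bullet z}(g),h)$; $MT_{a,z,w}(f,g,h)\leftrightarrow MT_{b,z,w}(\phi_{\bullet z}(f),g,\phi_{\bullet w}(h))$; $MT_{x,a,a}(f,g,h)\leftrightarrow MT_{x,b,b}(\phi_{x\bullet}(f),\phi_{\bullet\bullet}(g),\phi_{x\bullet}(h))$; $MT_{a,x,a}(f,g,h)\leftrightarrow MT_{b,x,b}(\phi_{\bullet x}(f),\phi_{x\bullet}(g),\phi_{\bullet\bullet}(h))$; $MT_{a,a,x}(f,g,h)\leftrightarrow MT_{b,b,x}(\phi_{\bullet\bullet}(f),\phi_{\bullet x}(g),\phi_{\bullet x}(h))$; $MT_{a,a,a}(f,g,h)\leftrightarrow MT_{b,b,b}(\phi_{\bullet\bullet}(f),\phi_{\bullet\bullet}(g),\phi_{\bullet\bullet}(h))$; and $MI_a(f)\leftrightarrow MI_b(\phi_{\bullet\bullet}(f))$. -}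

{-# OPTIONS --without-K #-}
module Defs where

open import Level using (Level; _⊔_; suc; Setω)
open import Data.Product using (Σ; Σ-syntax; _×_; _,_; proj₁; proj₂)
open import Relation.Binary.PropositionalEquality using (_≡_)

isContr : ∀ {ℓ} → Set ℓ → Set ℓ
isContr X = Σ[ c ∈ X ] ((x : X) → c ≡ x)

center : ∀ {ℓ} {X : Set ℓ} → isContr X → X
center = proj₁

isProp : ∀ {ℓ} → Set ℓ → Set ℓ
isProp X = (x y : X) → x ≡ y

isSet : ∀ {ℓ} → Set ℓ → Set ℓ
isSet X = (x y : X) → isProp (x ≡ y)

fiber : ∀ {ℓ ℓ'} {X : Set ℓ} {Y : Set ℓ'} → (X → Y) → Y → Set (ℓ ⊔ ℓ')
fiber {X = X} f y = Σ[ x ∈ X ] (f x ≡ y)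

isEquiv : ∀ {ℓ ℓ'} {X : Set ℓ} {Y : Set ℓ'} → (X → Y) → Set (ℓ ⊔ ℓ')
isEquiv {Y = Y} f = (y : Y) → isContr (fiber f y)

infix 4 _≃_
_≃_ : ∀ {ℓ ℓ'} → Set ℓ → Set ℓ' → Set (ℓ ⊔ ℓ')
X ≃ Y = Σ[ f ∈ (X → Y) ] isEquiv f

app : ∀ {ℓ ℓ'} {X : Set ℓ} {Y : Set ℓ'} → X ≃ Y → X → Y
app = proj₁

infix 3 _↔_
_↔_ : ∀ {ℓ ℓ'} → Set ℓ → Set ℓ' → Set (ℓ ⊔ ℓ')
P ↔ Q = (P → Q) × (Q → P)

FunExt : Setω
FunExt = ∀ {ℓ ℓ'} {X : Set ℓ} {Y : X → Set ℓ'} {f g : (x : X) → Y x} →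
         ((x : X) → f x ≡ g x) → f ≡ g

record FOLDSCat (ℓ : Level) : Set (suc ℓ) where
  field
    O     : Set ℓ
    A     : O → O → Set ℓ
    A-set : ∀ x y → isSet (A x y)
    I     : ∀ x → A x x → Set ℓ
    I-prop : ∀ x (f : A x x) → isProp (I x f)
    T     : ∀ {x y z} → A x y → A y z → A x z → Set ℓ
    T-prop : ∀ {x y z} (f : A x y) (g : A y z) (h : A x z) → isProp (T f g h)
    E     : ∀ {x y} → A x y → A x y → Set ℓ
    E-prop : ∀ {x y} (f g : A x y) → isProp (E f g)
    E-eq  : ∀ {x y} (f g : A x y) → E f g ↔ (f ≡ g)
    id-unique   : ∀ x → isContr (Σ[ i ∈ A x x ] I x i)
    comp-unique : ∀ {x y z} (f : A x y) (g : A y z) → isContr (Σ[ h ∈ A x z ] T f g h)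

  -- identity and composition (g ∘ f written comp g f)
  idn : ∀ x → A x x
  idn x = proj₁ (center (id-unique x))

  comp : ∀ {x y z} → A y z → A x y → A x z
  comp g f = proj₁ (center (comp-unique f g))

  Laws : Set ℓ
  Laws = (∀ {x y} (f : A x y) → comp (idn y) f ≡ f)
       × (∀ {x y} (f : A x y) → comp f (idn x) ≡ f)
       × (∀ {x y z w} (f : A x y) (g : A y z) (h : A z w) →
            comp h (comp g f) ≡ comp (comp h g) f)

record FOLDSCategory (ℓ : Level) : Set (suc ℓ) where
  field
    cat  : FOLDSCat ℓ
    laws : FOLDSCat.Laws cat
  open FOLDSCat cat public

module _ {ℓ} (M : FOLDSCategory ℓ) where
  open FOLDSCategory M

  Iso : O → O → Set ℓ
  Iso a b = Σ[ f ∈ A a b ] Σ[ g ∈ A b a ] ((comp g f ≡ idn a) × (comp f g ≡ idn b))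

  record Indisc (a b : O) : Set ℓ where
    field
      φx• : ∀ x → A x a ≃ A x b
      φ•z : ∀ z → A a z ≃ A b z
      φ•• : A a a ≃ A b b
      c1 : ∀ {x y} (f : A x y) (g : A y a) (h : A x a) →
             T f g h ↔ T f (app (φx• y) g) (app (φx• x) h)
      c2 : ∀ {x z} (f : A x a) (g : A a z) (h : A x z) →
             T f g h ↔ T (app (φx• x) f) (app (φ•z z) g) h
      c3 : ∀ {z w} (f : A a z) (g : A z w) (h : A a w) →
             T f g h ↔ T (app (φ•z z) f) g (app (φ•z w) h)
      c4 : ∀ {x} (f : A x a) (g : A a a) (h : A x a) →
             T f g h ↔ T (app (φx• x) f) (app φ•• g) (app (φx• x) h)
      c5 : ∀ {x} (f : A a x) (g : A x a) (h : A a a) →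
             T f g h ↔ T (app (φ•z x) f) (app (φx• x) g) (app φ•• h)
      c6 : ∀ {x} (f : A a a) (g : A a x) (h : A a x) →
             T f g h ↔ T (app φ•• f) (app (φ•z x) g) (app (φ•z x) h)
      c7 : (f g h : A a a) →
             T f g h ↔ T (app φ•• f) (app φ•• g) (app φ•• h)
      c8 : (f : A a a) → I a f ↔ I b (app φ•• f)

module Submission where

-- Because T and I are propositions characterised by `h ≡ g ∘ f` and
-- `k ≡ 1`, every coherence condition of an indiscernibility is an
-- equation between composites.  Hence:
--   * an isomorphism (f , g) yields the indiscernibility φx• = f ∘ -,
--     φ•z = - ∘ g, φ•• = f ∘ - ∘ g; each coherence condition is T (resp. I)
--     transported along an injective map, using associativity and the
--     inverse laws;
--   * an indiscernibility φ yields the isomorphism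
--     (φx•(1_a) , φ•z(1_a)), using coherences c2, c5 and c8 at identities;
--   * conversely coherences c1, c3 and c5 force φ to be of the form above,
--     and an indiscernibility is determined by its three equivalences since
--     the coherence conditions are propositions.

open import Data.Product using (Σ; _×_; _,_; proj₁; proj₂)
open import Data.Unit.Polymorphic using (⊤; tt)
open import Relation.Binary.PropositionalEquality
  using (_≡_; refl; sym; trans; cong; cong₂; subst; module ≡-Reasoning)
open import Relation.Binary.PropositionalEquality.Properties using (trans-reflʳ)
open import Defs

Σ-prop-≡ : ∀ {ℓ ℓ'} {X : Set ℓ} {B : X → Set ℓ'} → (∀ x → isProp (B x)) →
  {x x' : X} {b : B x} {b' : B x'} → x ≡ x' → _≡_ {A = Σ X B} (x , b) (x' , b')
Σ-prop-≡ P {x} {b = b} {b'} refl = cong (x ,_) (P x b b')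

trans-cancelˡ : ∀ {ℓ} {X : Set ℓ} {x y z : X} (c : x ≡ y) {p q : y ≡ z} →
  trans c p ≡ trans c q → p ≡ q
trans-cancelˡ refl e = e

reflexive-prop-relation→isSet : ∀ {ℓ ℓ'} {X : Set ℓ} (R : X → X → Set ℓ') →
  (∀ x y → isProp (R x y)) → (∀ x → R x x) → (∀ x y → R x y → x ≡ y) → isSet X
reflexive-prop-relation→isSet {X = X} R R-prop ρ e x y p q =
  trans-cancelˡ (e x x (ρ x))
    (trans (e-along p) (trans (cong (e x y) (R-prop x y _ _)) (sym (e-along q))))
  where
  e-along : ∀ {y} (p : x ≡ y) → trans (e x x (ρ x)) p ≡ e x y (subst (R x) p (ρ x))
  e-along refl = trans-reflʳ _

isProp→isSet : ∀ {ℓ} {X : Set ℓ} → isProp X → isSet X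
isProp→isSet {ℓ} P =
  reflexive-prop-relation→isSet (λ _ _ → ⊤ {ℓ}) (λ _ _ _ _ → refl) (λ _ → tt) (λ x y _ → P x y)

isContr→isProp : ∀ {ℓ} {X : Set ℓ} → isContr X → isProp X
isContr→isProp (c , h) x y = trans (sym (h x)) (h y)

isProp-isContr : FunExt → ∀ {ℓ} {X : Set ℓ} → isProp (isContr X)
isProp-isContr fe {X = X} (c , h) (c' , h') =
  Σ-prop-≡ (λ c k k' → fe λ x → X-set c x (k x) (k' x)) (h c')
  where
  X-set : isSet X
  X-set = isProp→isSet (isContr→isProp (c' , h'))

isProp-isEquiv : FunExt → ∀ {ℓ ℓ'} {X : Set ℓ} {Y : Set ℓ'} (f : X → Y) → isProp (isEquiv f)
isProp-isEquiv fe f e e' = fe λ y → isProp-isContr fe (e y) (e' y)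

≃-≡ : FunExt → ∀ {ℓ ℓ'} {X : Set ℓ} {Y : Set ℓ'} {e e' : X ≃ Y} →
  (∀ x → app e x ≡ app e' x) → e ≡ e'
≃-≡ fe h = Σ-prop-≡ (isProp-isEquiv fe) (fe h)

qinv→isEquiv : ∀ {ℓ ℓ'} {X : Set ℓ} {Y : Set ℓ'} → isSet Y → (f : X → Y) (g : Y → X) →
  (∀ x → g (f x) ≡ x) → (∀ y → f (g y) ≡ y) → isEquiv f
qinv→isEquiv Y-set f g η ε y =
  (g y , ε y) ,
  λ { (x , p) → Σ-prop-≡ (λ x → Y-set (f x) y) (trans (cong g (sym p)) (η x)) }

funext-implicit : FunExt → ∀ {ℓ ℓ'} {X : Set ℓ} {Y : X → Set ℓ'} {f g : {x : X} → Y x} →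
  ((x : X) → f {x} ≡ g {x}) → _≡_ {A = {x : X} → Y x} f g
funext-implicit fe h = cong (λ k {x} → k x) (fe h)

funext³ : FunExt → ∀ {ℓ₁ ℓ₂ ℓ₃ ℓ} {X : Set ℓ₁} {Y : X → Set ℓ₂} {Z : ∀ x → Y x → Set ℓ₃}
  {W : ∀ x y → Z x y → Set ℓ} {F G : ∀ x y z → W x y z} →
  (∀ x y z → F x y z ≡ G x y z) → F ≡ G
funext³ fe H = fe λ x → fe λ y → fe λ z → H x y z

isProp-↔ : FunExt → ∀ {ℓ ℓ'} {P : Set ℓ} {Q : Set ℓ'} → isProp P → isProp Q → isProp (P ↔ Q)
isProp-↔ fe P-prop Q-prop _ _ =
  cong₂ _,_ (fe λ p → Q-prop _ _) (fe λ q → P-prop _ _)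

↔-trans : ∀ {ℓ ℓ' ℓ''} {P : Set ℓ} {Q : Set ℓ'} {R : Set ℓ''} → P ↔ Q → Q ↔ R → P ↔ R
↔-trans (to , from) (to' , from') = (λ p → to' (to p)) , (λ r → from (from' r))

↔-sym : ∀ {ℓ ℓ'} {P : Set ℓ} {Q : Set ℓ'} → P ↔ Q → Q ↔ P
↔-sym (to , from) = from , to

retract-≡-↔ : ∀ {ℓ ℓ'} {X : Set ℓ} {Y : Set ℓ'} (Φ : X → Y) (Ψ : Y → X) →
  (∀ x → Ψ (Φ x) ≡ x) → {u v : X} {v' : Y} → v' ≡ Φ v → (u ≡ v) ↔ (Φ u ≡ v')
retract-≡-↔ Φ Ψ η {u} {v} q =
  (λ p → trans (cong Φ p) (sym q)) ,
  (λ p → trans (sym (η u)) (trans (cong Ψ (trans p q)) (η v)))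

module CategoryFacts {ℓ} (M : FOLDSCategory ℓ) where
  open FOLDSCategory M

  identityˡ : ∀ {x y} (f : A x y) → comp (idn y) f ≡ f
  identityˡ = proj₁ laws

  identityʳ : ∀ {x y} (f : A x y) → comp f (idn x) ≡ f
  identityʳ = proj₁ (proj₂ laws)

  assoc : ∀ {x y z w} (f : A x y) (g : A y z) (h : A z w) →
    comp h (comp g f) ≡ comp (comp h g) f
  assoc = proj₂ (proj₂ laws)

  T↔comp : ∀ {x y z} {f : A x y} {g : A y z} {h : A x z} → T f g h ↔ (h ≡ comp g f)
  T↔comp {f = f} {g} {h} =
    (λ t → sym (cong proj₁ (proj₂ (comp-unique f g) (h , t)))) ,
    (λ e → subst (T f g) (sym e) (proj₂ (center (comp-unique f g))))

  I↔idn : ∀ {x} {k : A x x} → I x k ↔ (k ≡ idn x)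
  I↔idn {x} {k} =
    (λ t → sym (cong proj₁ (proj₂ (id-unique x) (k , t)))) ,
    (λ e → subst (I x) (sym e) (proj₂ (center (id-unique x))))

  T-transfer : ∀ {x y z x' y' z'} {f : A x y} {g : A y z} {h : A x z}
    {f' : A x' y'} {g' : A y' z'} (Φ : A x z → A x' z') (Ψ : A x' z' → A x z) →
    (∀ k → Ψ (Φ k) ≡ k) → comp g' f' ≡ Φ (comp g f) → T f g h ↔ T f' g' (Φ h)
  T-transfer Φ Ψ η e = ↔-trans T↔comp (↔-trans (retract-≡-↔ Φ Ψ η e) (↔-sym T↔comp))

  I-transfer : ∀ {x x'} {k : A x x} (Φ : A x x → A x' x') (Ψ : A x' x' → A x x) →
    (∀ k → Ψ (Φ k) ≡ k) → idn x' ≡ Φ (idn x) → I x k ↔ I x' (Φ k)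
  I-transfer Φ Ψ η e = ↔-trans I↔idn (↔-trans (retract-≡-↔ Φ Ψ η e) (↔-sym I↔idn))

  module LeftInverse {x y} (f : A x y) (g : A y x) (gf : comp g f ≡ idn x) where

    cancelˡ : ∀ {z} (w : A z x) → comp g (comp f w) ≡ w
    cancelˡ w = begin
      comp g (comp f w)   ≡⟨ assoc w f g ⟩
      comp (comp g f) w   ≡⟨ cong (λ k → comp k w) gf ⟩
      comp (idn x) w      ≡⟨ identityˡ w ⟩
      w                   ∎
      where open ≡-Reasoning

    cancelʳ : ∀ {z} (w : A x z) → comp (comp w g) f ≡ w
    cancelʳ w = begin
      comp (comp w g) f   ≡⟨ sym (assoc f g w) ⟩
      comp w (comp g f)   ≡⟨ cong (comp w) gf ⟩
      comp w (idn x)      ≡⟨ identityʳ w ⟩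
      w                   ∎
      where open ≡-Reasoning

    cancel-middle : ∀ {u v} (k : A x v) (l : A u x) → comp (comp k g) (comp f l) ≡ comp k l
    cancel-middle k l = trans (sym (assoc (comp f l) g k)) (cong (comp k) (cancelˡ l))

  module IsoAction {x y} (f : A x y) (g : A y x)
                   (gf : comp g f ≡ idn x) (fg : comp f g ≡ idn y) where
    open LeftInverse f g gf public
    private
      module Inverse = LeftInverse g f fg

    post : ∀ {z} → A z x → A z y
    post = comp f

    pre : ∀ {z} → A x z → A y z
    pre w = comp w g

    conj : A x x → A y y
    conj k = comp f (comp k g)

    unconj : A y y → A x x
    unconj k = comp g (comp k f)

    unconj-conj : ∀ k → unconj (conj k) ≡ k
    unconj-conj k = trans (cong (comp g) (trans (sym (assoc f (comp k g) f))
                                                 (cong (comp f) (cancelʳ k))))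
                          (cancelˡ k)

    conj-unconj : ∀ k → conj (unconj k) ≡ k
    conj-unconj k = trans (cong (comp f) (trans (sym (assoc g (comp k f) g))
                                                 (cong (comp g) (Inverse.cancelʳ k))))
                          (Inverse.cancelˡ k)

    post-≃ : ∀ z → A z x ≃ A z y
    post-≃ z = post , qinv→isEquiv (A-set _ _) post (comp g) cancelˡ Inverse.cancelˡ

    pre-≃ : ∀ z → A x z ≃ A y z
    pre-≃ z = pre , qinv→isEquiv (A-set _ _) pre (λ w → comp w f) cancelʳ Inverse.cancelʳ

    conj-≃ : A x x ≃ A y y
    conj-≃ = conj , qinv→isEquiv (A-set _ _) conj unconj unconj-conj conj-unconj

module Correspondence (fe : FunExt) {ℓ} (M : FOLDSCategory ℓ) (a b : FOLDSCategory.O M) where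
  open FOLDSCategory M
  open CategoryFacts M
  open Indisc

  -- An isomorphism is determined by its two morphisms, as the inverse laws
  -- live in hom-sets.
  Iso-≡ : {f f' : A a b} {g g' : A b a} {p : (comp g f ≡ idn a) × (comp f g ≡ idn b)}
    {p' : (comp g' f' ≡ idn a) × (comp f' g' ≡ idn b)} →
    f ≡ f' → g ≡ g' → _≡_ {A = Iso M a b} (f , g , p) (f' , g' , p')
  Iso-≡ refl refl = cong (λ p → _ , _ , p) (cong₂ _,_ (A-set _ _ _ _ _ _) (A-set _ _ _ _ _ _))

  Iso-isSet : isSet (Iso M a b)
  Iso-isSet = reflexive-prop-relation→isSet SameMorphisms SameMorphisms-prop
                (λ _ → refl , refl) (λ { _ _ (p , q) → Iso-≡ p q })
    where
    SameMorphisms : Iso M a b → Iso M a b → Set ℓ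
    SameMorphisms (f , g , _) (f' , g' , _) = (f ≡ f') × (g ≡ g')
    SameMorphisms-prop : ∀ i j → isProp (SameMorphisms i j)
    SameMorphisms-prop _ _ (p , q) (p' , q') =
      cong₂ _,_ (A-set _ _ _ _ p p') (A-set _ _ _ _ q q')

  -- An isomorphism acts as an indiscernibility: each coherence condition
  -- is T (or I) transported along one of the actions, which applies since
  -- the action carries the old composite to the new one.
  iso→indisc : Iso M a b → Indisc M a b
  iso→indisc (f , g , gf , fg) = record
    { φx• = post-≃ ; φ•z = pre-≃ ; φ•• = conj-≃
    ; c1 = λ f' g' h' → T-transfer post (comp g) cancelˡ (sym (assoc f' g' f))
    ; c2 = λ f' g' h' → T-transfer (λ w → w) (λ w → w) (λ _ → refl) (cancel-middle g' f')
    ; c3 = λ f' g' h' → T-transfer pre (λ w → comp w f) cancelʳ (assoc g f' g')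
    ; c4 = λ f' g' h' → T-transfer post (comp g) cancelˡ (c4-composite f' g')
    ; c5 = λ f' g' h' → T-transfer conj unconj unconj-conj (c5-composite f' g')
    ; c6 = λ f' g' h' → T-transfer pre (λ w → comp w f) cancelʳ (c6-composite f' g')
    ; c7 = λ f' g' h' → T-transfer conj unconj unconj-conj (c7-composite f' g')
    ; c8 = λ k → I-transfer conj unconj unconj-conj conj-idn
    }
    where
    open IsoAction f g gf fg
    open ≡-Reasoning

    c4-composite : ∀ {x} (f' : A x a) (g' : A a a) → comp (conj g') (post f') ≡ post (comp g' f')
    c4-composite f' g' = begin
      comp (comp f (comp g' g)) (comp f f')   ≡⟨ sym (assoc (comp f f') (comp g' g) f) ⟩
      comp f (comp (comp g' g) (comp f f'))   ≡⟨ cong (comp f) (cancel-middle g' f') ⟩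
      comp f (comp g' f')                     ∎

    c5-composite : ∀ {x} (f' : A a x) (g' : A x a) → comp (post g') (pre f') ≡ conj (comp g' f')
    c5-composite f' g' = begin
      comp (comp f g') (comp f' g)   ≡⟨ sym (assoc (comp f' g) g' f) ⟩
      comp f (comp g' (comp f' g))   ≡⟨ cong (comp f) (assoc g f' g') ⟩
      comp f (comp (comp g' f') g)   ∎

    c6-composite : ∀ {x} (f' : A a a) (g' : A a x) → comp (pre g') (conj f') ≡ pre (comp g' f')
    c6-composite f' g' = begin
      comp (comp g' g) (comp f (comp f' g))   ≡⟨ cancel-middle g' (comp f' g) ⟩
      comp g' (comp f' g)                     ≡⟨ assoc g f' g' ⟩
      comp (comp g' f') g                     ∎

    c7-composite : (f' g' : A a a) → comp (conj g') (conj f') ≡ conj (comp g' f')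
    c7-composite f' g' = begin
      comp (comp f (comp g' g)) (comp f (comp f' g))   ≡⟨ sym (assoc (comp f (comp f' g)) (comp g' g) f) ⟩
      comp f (comp (comp g' g) (comp f (comp f' g)))   ≡⟨ cong (comp f) (c6-composite f' g') ⟩
      comp f (comp (comp g' f') g)                     ∎

    conj-idn : idn b ≡ conj (idn a)
    conj-idn = sym (trans (cong (comp f) (identityˡ g)) fg)

  module _ (φ : Indisc M a b) where

    forward : A a b
    forward = app (φx• φ a) (idn a)

    backward : A b a
    backward = app (φ•z φ a) (idn a)

    private
      T-idn : T (idn a) (idn a) (idn a)
      T-idn = proj₂ T↔comp (sym (identityˡ (idn a)))

    backward-forward : comp backward forward ≡ idn a
    backward-forward = sym (proj₁ T↔comp (proj₁ (c2 φ (idn a) (idn a) (idn a)) T-idn))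

    forward-backward : comp forward backward ≡ idn b
    forward-backward = begin
      comp forward backward   ≡⟨ sym (proj₁ T↔comp (proj₁ (c5 φ (idn a) (idn a) (idn a)) T-idn)) ⟩
      app (φ•• φ) (idn a)     ≡⟨ proj₁ I↔idn (proj₁ (c8 φ (idn a)) (proj₂ I↔idn refl)) ⟩
      idn b                   ∎
      where open ≡-Reasoning

    φx•-post : ∀ {x} (h : A x a) → app (φx• φ x) h ≡ comp forward h
    φx•-post h = proj₁ T↔comp (proj₁ (c1 φ h (idn a) h) (proj₂ T↔comp (sym (identityˡ h))))

    φ•z-pre : ∀ {z} (k : A a z) → app (φ•z φ z) k ≡ comp k backward
    φ•z-pre k = proj₁ T↔comp (proj₁ (c3 φ (idn a) k k) (proj₂ T↔comp (sym (identityʳ k))))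

    φ••-conj : (k : A a a) → app (φ•• φ) k ≡ comp forward (comp k backward)
    φ••-conj k = begin
      app (φ•• φ) k                        ≡⟨ proj₁ T↔comp (proj₁ (c5 φ (idn a) k k) T-k) ⟩
      comp (app (φx• φ a) k) backward      ≡⟨ cong (λ w → comp w backward) (φx•-post k) ⟩
      comp (comp forward k) backward       ≡⟨ sym (assoc backward k forward) ⟩
      comp forward (comp k backward)       ∎
      where
      open ≡-Reasoning
      T-k : T (idn a) k k
      T-k = proj₂ T↔comp (sym (identityʳ k))

  indisc→iso : Indisc M a b → Iso M a b
  indisc→iso φ = forward φ , backward φ , backward-forward φ , forward-backward φ

  -- An indiscernibility is determined by its three equivalences, since
  -- all coherence conditions are (families of) propositions.
  Indisc-≡ : (φ ψ : Indisc M a b) →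
    φx• φ ≡ φx• ψ → φ•z φ ≡ φ•z ψ → φ•• φ ≡ φ•• ψ → φ ≡ ψ
  Indisc-≡ record { φx• = p ; φ•z = q ; φ•• = r ; c1 = c1 ; c2 = c2 ; c3 = c3 ; c4 = c4
                  ; c5 = c5 ; c6 = c6 ; c7 = c7 ; c8 = c8 }
           record { φx• = .p ; φ•z = .q ; φ•• = .r ; c1 = c1' ; c2 = c2' ; c3 = c3' ; c4 = c4'
                  ; c5 = c5' ; c6 = c6' ; c7 = c7' ; c8 = c8' }
           refl refl refl
    with funext-implicit fe (λ x → funext-implicit fe λ y →
           funext³ fe λ f g h → T-coh (c1 {x} {y} f g h) (c1' f g h))
       | funext-implicit fe (λ x → funext-implicit fe λ z →
           funext³ fe λ f g h → T-coh (c2 {x} {z} f g h) (c2' f g h))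
       | funext-implicit fe (λ z → funext-implicit fe λ w →
           funext³ fe λ f g h → T-coh (c3 {z} {w} f g h) (c3' f g h))
       | funext-implicit fe (λ x → funext³ fe λ f g h → T-coh (c4 {x} f g h) (c4' f g h))
       | funext-implicit fe (λ x → funext³ fe λ f g h → T-coh (c5 {x} f g h) (c5' f g h))
       | funext-implicit fe (λ x → funext³ fe λ f g h → T-coh (c6 {x} f g h) (c6' f g h))
       | funext³ fe (λ f g h → T-coh (c7 f g h) (c7' f g h))
       | fe (λ k → isProp-↔ fe (I-prop _ _) (I-prop _ _) (c8 k) (c8' k))
    where
    T-coh : ∀ {x y z x' y' z'} {f : A x y} {g : A y z} {h : A x z}
      {f' : A x' y'} {g' : A y' z'} {h' : A x' z'} → isProp (T f g h ↔ T f' g' h')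
    T-coh = isProp-↔ fe (T-prop _ _ _) (T-prop _ _ _)
  ... | refl | refl | refl | refl | refl | refl | refl | refl = refl

  indisc→iso→indisc : ∀ φ → iso→indisc (indisc→iso φ) ≡ φ
  indisc→iso→indisc φ = Indisc-≡ _ φ
    (fe λ x → ≃-≡ fe λ h → sym (φx•-post φ h))
    (fe λ z → ≃-≡ fe λ k → sym (φ•z-pre φ k))
    (≃-≡ fe λ k → sym (φ••-conj φ k))

  -- φx•(1_a) = f ∘ 1_a and φ•z(1_a) = 1_a ∘ g for the indiscernibility of (f , g).
  iso→indisc→iso : ∀ i → indisc→iso (iso→indisc i) ≡ i
  iso→indisc→iso (f , g , _) = Iso-≡ (identityʳ f) (identityˡ g)

theorem2p6 : FunExt → ∀ {ℓ} (M : FOLDSCategory ℓ) (a b : FOLDSCategory.O M) →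
    Indisc M a b ≃ Iso M a b
theorem2p6 fe M a b =
  indisc→iso , qinv→isEquiv Iso-isSet indisc→iso iso→indisc indisc→iso→indisc iso→indisc→iso
  where open Correspondence fe M a b
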